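{- Let $q>2$ be a prime power, $s\geq 3$ an integer, and let $\Omega$ be a non-empty family of hyperplanes of $\mathrm{PG}(s,q^2)$ such that every point lies in exactly $\frac{q^s(q^{s-1}-(-1)^{s-1})}{q+1}$ or exactly $\frac{q^{s-1}(q^s-(-1)^s)}{q+1}$ hyperplanes of $\Omega$. Call a point black if it lies in exactly $\frac{q^s(q^{s-1}-(-1)^{s-1})}{q+1}$ hyperplanes of $\Omega$. Then every hyperplane of $\Omega$ contains exactly $N_{s-1}=\frac{(q^{s}+(-1)^{s-1})(q^{s-1}-(-1)^{s-1})}{q^2-1}$ black points.
   Context: $N_{s-1}$ is the number of points of a non-singular hermitian variety $\mathcal H(s-1,q^2)$. -}

module Defs where

open import Data.Nat using (ℕ; zero; suc; _^_)
open import Data.Bool using (Bool; true; false; _∧_; _∨_; not; T)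
open import Data.Fin using (Fin)
open import Data.Fin.Properties using () renaming (_≟_ to _≟ᶠ_)
open import Data.Vec using (Vec; []; _∷_; zipWith; foldr)
open import Data.List using (List; [_]; concatMap; map; allFin; filterᵇ; length)
open import Data.Integer using (ℤ; +_; -[1+_]) renaming (_*_ to _*ℤ_; _+_ to _+ℤ_; _-_ to _-ℤ_; _^_ to _^ℤ_)
open import Data.Product using (∃; _×_)
open import Algebra.Core using (Op₁; Op₂)
open import Algebra.Structures using (IsCommutativeRing)
open import Relation.Binary.PropositionalEquality using (_≡_; _≢_)
open import Relation.Nullary.Decidable using (⌊_⌋)
open import Data.Integer using () renaming (_≟_ to _≟ℤ_)

record FieldOn (C : Set) : Set where
  field
    _+_ _*_ : Op₂ C
    -_ : Op₁ C
    0# 1# : C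
    isCommutativeRing : IsCommutativeRing _≡_ _+_ _*_ -_ 0# 1#
    0≢1 : 0# ≢ 1#
    inverse : ∀ x → x ≢ 0# → ∃ λ y → x * y ≡ 1#

open import Data.Nat.Primality using (Prime)
IsPrimePower : ℕ → Set
IsPrimePower q = ∃ λ p → ∃ λ k → Prime p × q ≡ p ^ suc k

allVecs : (m n : ℕ) → List (Vec (Fin m) n)
allVecs m zero = [ [] ]
allVecs m (suc n) = concatMap (λ x → map (x ∷_) (allVecs m n)) (allFin m)

neg1^ : ℕ → ℤ
neg1^ k = -[1+ 0 ] ^ℤ k

module Projective {m : ℕ} (F : FieldOn (Fin m)) where
  open FieldOn F

  -- canonical representative of a projective point / hyperplane of PG(n-1, F):
  -- the first non-zero coordinate equals 1
  normalized : ∀ {n} → Vec (Fin m) n → Bool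
  normalized [] = false
  normalized (x ∷ xs) = (⌊ x ≟ᶠ 0# ⌋ ∧ normalized xs) ∨ ⌊ x ≟ᶠ 1# ⌋

  dot : ∀ {n} → Vec (Fin m) n → Vec (Fin m) n → Fin m
  dot u v = foldr _ _+_ 0# (zipWith _*_ u v)

  incident : ∀ {n} → Vec (Fin m) n → Vec (Fin m) n → Bool
  incident H P = ⌊ dot H P ≟ᶠ 0# ⌋

  -- points (equivalently, hyperplanes) of PG(s, F): normalized nonzero vectors of length s+1
  points : (s : ℕ) → List (Vec (Fin m) (suc s))
  points s = filterᵇ normalized (allVecs m (suc s))

  hyperplanes : (s : ℕ) → List (Vec (Fin m) (suc s))
  hyperplanes = points

  degree : ∀ s → (Ω : Vec (Fin m) (suc s) → Bool) → Vec (Fin m) (suc s) → ℕ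
  degree s Ω P = length (filterᵇ (λ H → Ω H ∧ incident H P) (hyperplanes s))

-- "n = num / den" expressed exactly in ℤ as den * n = num
_≐_÷_ : ℕ → ℤ → ℤ → Set
n ≐ num ÷ den = den *ℤ (+ n) ≡ num

blackNum : ℕ → ℕ → ℤ
blackNum q s = ((+ q) ^ℤ s) *ℤ (((+ q) ^ℤ (s Data.Nat.∸ 1)) -ℤ neg1^ (s Data.Nat.∸ 1))

whiteNum : ℕ → ℕ → ℤ
whiteNum q s = ((+ q) ^ℤ (s Data.Nat.∸ 1)) *ℤ (((+ q) ^ℤ s) -ℤ neg1^ s)

hermNum : ℕ → ℕ → ℤ
hermNum q s = (((+ q) ^ℤ s) +ℤ neg1^ (s Data.Nat.∸ 1)) *ℤ (((+ q) ^ℤ (s Data.Nat.∸ 1)) -ℤ neg1^ (s Data.Nat.∸ 1))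

isBlack : ∀ {m} (F : FieldOn (Fin m)) (q s : ℕ) (Ω : Vec (Fin m) (suc s) → Bool) → Vec (Fin m) (suc s) → Bool
isBlack F q s Ω P = ⌊ (+ (suc q)) *ℤ (+ Projective.degree F s Ω P) ≟ℤ blackNum q s ⌋

{-# OPTIONS --safe #-}
module Submission where

-- Write c = q + 1, x = q^(s-1) and e = (-1)^(s-1): a point is black when c·deg = β = q x (x - e) and
-- white when c·deg = ω = x (q x + e).  Let n = |Ω|.  Since a hyperplane is a PG(s-1, q²) and two
-- hyperplanes meet in a PG(s-2, q²), double counting expresses ∑ deg, ∑ deg² and, for H ∈ Ω,
-- ∑_{P ∈ H} deg in terms of n.  As c·deg ∈ {β, ω} everywhere, ∑ (c·deg - β)(c·deg - ω) = 0: a quadratic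
-- in n that factors as (x - e)(c n - q x (q² x - e)) V(n).  Modulo x + e, V(n) is e (q² - 1)(q - 1),
-- which x + e does not divide (by size when x ≥ q³, and as q² + 1 ∤ 2(q - 1) when x = q²); hence
-- c n = q x (q² x - e).  On H the b black and w white points satisfy b + w = |PG(s-1, q²)| and
-- β b + ω w = c ∑_{P ∈ H} deg, and solving gives (q² - 1) b = (q x + e)(x - e).

open import Defs
open import Data.Nat using (ℕ; suc)
open import Data.Integer using (ℤ)
open import Data.Fin using (Fin)
open import Data.Vec using (Vec)
open import Data.Bool using (Bool)
open import Algebra.Structures using (IsCommutativeRing)

module Sums where
  open import Data.Nat using (ℕ; zero; suc; _+_; _*_; _^_)
  open import Data.Nat.Properties hiding (suc-injective)
  open import Data.Bool using (Bool; true; false; _∧_; not; T)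
  open import Data.List using (List; []; _∷_; _++_; map; concatMap; length; filterᵇ; tabulate; allFin)
  open import Data.List.Membership.Propositional using (_∈_)
  open import Data.List.Relation.Unary.Any using (here; there)
  open import Data.Fin using (Fin; zero; suc)
  open import Data.Fin.Properties using (suc-injective)
  open import Data.List.Properties using (length-tabulate; map-tabulate)
  open import Function using (_∘_)
  open import Data.Vec using (Vec; []; _∷_)
  open import Data.Vec.Properties using (∷-injectiveˡ; ∷-injectiveʳ)
  open import Relation.Binary.PropositionalEquality
  open ≡-Reasoning

  private variable
    A B : Set

  ⟦_⟧ : Bool → ℕ
  ⟦ true ⟧ = 1
  ⟦ false ⟧ = 0

  T⇒⟦⟧≡1 : ∀ {b} → T b → ⟦ b ⟧ ≡ 1
  T⇒⟦⟧≡1 {true} _ = refl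

  ⟦∧⟧ : ∀ a b → ⟦ a ∧ b ⟧ ≡ ⟦ a ⟧ * ⟦ b ⟧
  ⟦∧⟧ true b = sym (+-identityʳ ⟦ b ⟧)
  ⟦∧⟧ false b = refl

  ⟦∧⟧+⟦∧not⟧ : ∀ a b → ⟦ a ∧ b ⟧ + ⟦ a ∧ not b ⟧ ≡ ⟦ a ⟧
  ⟦∧⟧+⟦∧not⟧ true true = refl
  ⟦∧⟧+⟦∧not⟧ true false = refl
  ⟦∧⟧+⟦∧not⟧ false b = refl

  ⟦⟧-idem : ∀ a → ⟦ a ⟧ * ⟦ a ⟧ ≡ ⟦ a ⟧
  ⟦⟧-idem true = refl
  ⟦⟧-idem false = refl

  ∑ : List A → (A → ℕ) → ℕ
  ∑ [] f = 0
  ∑ (x ∷ xs) f = f x + ∑ xs f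

  ∑-++ : (xs ys : List A) (f : A → ℕ) → ∑ (xs ++ ys) f ≡ ∑ xs f + ∑ ys f
  ∑-++ [] ys f = refl
  ∑-++ (x ∷ xs) ys f = trans (cong (f x +_) (∑-++ xs ys f)) (sym (+-assoc (f x) _ _))

  ∑-congᴹ : (xs : List A) {f g : A → ℕ} → (∀ x → x ∈ xs → f x ≡ g x) → ∑ xs f ≡ ∑ xs g
  ∑-congᴹ [] e = refl
  ∑-congᴹ (x ∷ xs) e = cong₂ _+_ (e x (here refl)) (∑-congᴹ xs (λ y y∈xs → e y (there y∈xs)))

  ∑-cong : (xs : List A) {f g : A → ℕ} → (∀ x → f x ≡ g x) → ∑ xs f ≡ ∑ xs g
  ∑-cong xs e = ∑-congᴹ xs (λ x _ → e x)

  ∑-+ : (xs : List A) (f g : A → ℕ) → ∑ xs (λ x → f x + g x) ≡ ∑ xs f + ∑ xs g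
  ∑-+ [] f g = refl
  ∑-+ (x ∷ xs) f g = begin
    f x + g x + ∑ xs (λ x → f x + g x) ≡⟨ cong (f x + g x +_) (∑-+ xs f g) ⟩
    f x + g x + (∑ xs f + ∑ xs g)      ≡⟨ +-assoc (f x) (g x) _ ⟩
    f x + (g x + (∑ xs f + ∑ xs g))    ≡⟨ cong (f x +_) (+-comm (g x) _) ⟩
    f x + ((∑ xs f + ∑ xs g) + g x)    ≡⟨ cong (f x +_) (+-assoc (∑ xs f) _ _) ⟩
    f x + (∑ xs f + (∑ xs g + g x))    ≡⟨ cong (λ y → f x + (∑ xs f + y)) (+-comm (∑ xs g) (g x)) ⟩
    f x + (∑ xs f + (g x + ∑ xs g))    ≡⟨ +-assoc (f x) _ _ ⟨
    f x + ∑ xs f + (g x + ∑ xs g)      ∎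

  ∑-*ˡ : (xs : List A) (c : ℕ) (f : A → ℕ) → ∑ xs (λ x → c * f x) ≡ c * ∑ xs f
  ∑-*ˡ [] c f = sym (*-zeroʳ c)
  ∑-*ˡ (x ∷ xs) c f = trans (cong (c * f x +_) (∑-*ˡ xs c f)) (sym (*-distribˡ-+ c (f x) _))

  ∑-const : (xs : List A) (c : ℕ) → ∑ xs (λ _ → c) ≡ length xs * c
  ∑-const [] c = refl
  ∑-const (x ∷ xs) c = cong (c +_) (∑-const xs c)

  ∑-filterᵇ : (p : A → Bool) (xs : List A) (f : A → ℕ) → ∑ (filterᵇ p xs) f ≡ ∑ xs (λ x → ⟦ p x ⟧ * f x)
  ∑-filterᵇ p [] f = refl
  ∑-filterᵇ p (x ∷ xs) f with p x
  ... | true = cong₂ _+_ (sym (+-identityʳ (f x))) (∑-filterᵇ p xs f)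
  ... | false = ∑-filterᵇ p xs f

  length-filterᵇ : (p : A → Bool) (xs : List A) → length (filterᵇ p xs) ≡ ∑ xs (λ x → ⟦ p x ⟧)
  length-filterᵇ p xs = begin
    length (filterᵇ p xs)          ≡⟨ *-identityʳ _ ⟨
    length (filterᵇ p xs) * 1      ≡⟨ ∑-const (filterᵇ p xs) 1 ⟨
    ∑ (filterᵇ p xs) (λ _ → 1)     ≡⟨ ∑-filterᵇ p xs (λ _ → 1) ⟩
    ∑ xs (λ x → ⟦ p x ⟧ * 1)       ≡⟨ ∑-cong xs (λ x → *-identityʳ ⟦ p x ⟧) ⟩
    ∑ xs (λ x → ⟦ p x ⟧)           ∎

  ∑-map : (g : A → B) (xs : List A) (f : B → ℕ) → ∑ (map g xs) f ≡ ∑ xs (λ x → f (g x))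
  ∑-map g [] f = refl
  ∑-map g (x ∷ xs) f = cong (f (g x) +_) (∑-map g xs f)

  ∑-concatMap : (g : A → List B) (xs : List A) (f : B → ℕ) → ∑ (concatMap g xs) f ≡ ∑ xs (λ x → ∑ (g x) f)
  ∑-concatMap g [] f = refl
  ∑-concatMap g (x ∷ xs) f = trans (∑-++ (g x) (concatMap g xs) f) (cong (∑ (g x) f +_) (∑-concatMap g xs f))

  ∑-swap : (xs : List A) (ys : List B) (f : A → B → ℕ) →
    ∑ xs (λ x → ∑ ys (f x)) ≡ ∑ ys (λ y → ∑ xs (λ x → f x y))
  ∑-swap [] ys f = sym (trans (∑-const ys 0) (*-zeroʳ (length ys)))
  ∑-swap (x ∷ xs) ys f = trans (cong (∑ ys (f x) +_) (∑-swap xs ys f)) (sym (∑-+ ys (f x) _))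

  ∑-allFin-const : (m c : ℕ) → ∑ (allFin m) (λ _ → c) ≡ m * c
  ∑-allFin-const m c = trans (∑-const (allFin m) c) (cong (_* c) (length-tabulate {n = m} (λ i → i)))

  ∑-allFin-suc : (m : ℕ) (f : Fin (suc m) → ℕ) → ∑ (allFin (suc m)) f ≡ f zero + ∑ (allFin m) (λ x → f (suc x))
  ∑-allFin-suc m f = cong (f zero +_) (begin
    ∑ (tabulate suc) f             ≡⟨ cong (λ xs → ∑ xs f) (map-tabulate (λ x → x) suc) ⟨
    ∑ (map suc (allFin m)) f       ≡⟨ ∑-map suc (allFin m) f ⟩
    ∑ (allFin m) (λ x → f (suc x)) ∎)

  ∑-allFin-δ : (m : ℕ) (a : Fin m) (f : Fin m → ℕ) → (∀ x → x ≢ a → f x ≡ 0) → ∑ (allFin m) f ≡ f a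
  ∑-allFin-δ (suc m) zero f off = begin
    ∑ (allFin (suc m)) f                     ≡⟨ ∑-allFin-suc m f ⟩
    f zero + ∑ (allFin m) (λ x → f (suc x))  ≡⟨ cong (f zero +_) (∑-cong (allFin m) (λ x → off (suc x) λ ())) ⟩
    f zero + ∑ (allFin m) (λ _ → 0)          ≡⟨ cong (f zero +_) (trans (∑-allFin-const m 0) (*-zeroʳ m)) ⟩
    f zero + 0                               ≡⟨ +-identityʳ (f zero) ⟩
    f zero                                   ∎
  ∑-allFin-δ (suc m) (suc a) f off = begin
    ∑ (allFin (suc m)) f                     ≡⟨ ∑-allFin-suc m f ⟩
    f zero + ∑ (allFin m) (λ x → f (suc x))  ≡⟨ cong (_+ ∑ (allFin m) (λ x → f (suc x))) (off zero λ ()) ⟩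
    ∑ (allFin m) (λ x → f (suc x))           ≡⟨ ∑-allFin-δ m a _ (λ x x≢a → off (suc x) (x≢a ∘ suc-injective)) ⟩
    f (suc a)                                ∎

  ∑-allVecs-suc : (m n : ℕ) (f : Vec (Fin m) (suc n) → ℕ) →
    ∑ (allVecs m (suc n)) f ≡ ∑ (allFin m) (λ x → ∑ (allVecs m n) (λ v → f (x ∷ v)))
  ∑-allVecs-suc m n f = trans (∑-concatMap (λ x → map (x ∷_) (allVecs m n)) (allFin m) f)
                              (∑-cong (allFin m) (λ x → ∑-map (x ∷_) (allVecs m n) f))

  ∑-allVecs-const : (m n c : ℕ) → ∑ (allVecs m n) (λ _ → c) ≡ m ^ n * c
  ∑-allVecs-const m zero c = refl
  ∑-allVecs-const m (suc n) c = begin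
    ∑ (allVecs m (suc n)) (λ _ → c)                 ≡⟨ ∑-allVecs-suc m n (λ _ → c) ⟩
    ∑ (allFin m) (λ _ → ∑ (allVecs m n) (λ _ → c))  ≡⟨ ∑-cong (allFin m) (λ _ → ∑-allVecs-const m n c) ⟩
    ∑ (allFin m) (λ _ → m ^ n * c)                  ≡⟨ ∑-allFin-const m (m ^ n * c) ⟩
    m * (m ^ n * c)                                 ≡⟨ *-assoc m (m ^ n) c ⟨
    m ^ suc n * c                                   ∎

  ∑-allVecs-δ : (m n : ℕ) (w : Vec (Fin m) n) (f : Vec (Fin m) n → ℕ) → (∀ v → v ≢ w → f v ≡ 0) →
    ∑ (allVecs m n) f ≡ f w
  ∑-allVecs-δ m zero [] f off = +-identityʳ (f [])
  ∑-allVecs-δ m (suc n) (x ∷ w) f off = begin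
    ∑ (allVecs m (suc n)) f                                  ≡⟨ ∑-allVecs-suc m n f ⟩
    ∑ (allFin m) (λ y → ∑ (allVecs m n) (λ v → f (y ∷ v)))   ≡⟨ ∑-allFin-δ m x _ off-head ⟩
    ∑ (allVecs m n) (λ v → f (x ∷ v))
      ≡⟨ ∑-allVecs-δ m n w _ (λ v v≢w → off (x ∷ v) (v≢w ∘ ∷-injectiveʳ)) ⟩
    f (x ∷ w)                                                ∎
    where
    off-head : ∀ y → y ≢ x → ∑ (allVecs m n) (λ v → f (y ∷ v)) ≡ 0
    off-head y y≢x = begin
      ∑ (allVecs m n) (λ v → f (y ∷ v))  ≡⟨ ∑-cong (allVecs m n) (λ v → off (y ∷ v) (y≢x ∘ ∷-injectiveˡ)) ⟩
      ∑ (allVecs m n) (λ _ → 0)          ≡⟨ ∑-allVecs-const m n 0 ⟩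
      m ^ n * 0                          ≡⟨ *-zeroʳ (m ^ n) ⟩
      0                                  ∎

module IntegerRelations where
  open import Data.Nat as ℕ using (ℕ)
  open import Data.Nat.Properties using (+-identityʳ)
  open import Data.Integer using (ℤ; +_; 0ℤ; 1ℤ; _+_; _*_)
  open import Data.Integer.Properties using (pos-+; pos-*; *-zeroʳ; *-distribˡ-+)
  open import Data.Bool using (true; false; _∧_; not; if_then_else_)
  open import Data.Integer.Tactic.RingSolver using (solve-∀)
  open import Data.List using (List; []; _∷_)
  open import Data.List.Membership.Propositional using (_∈_)
  open import Data.List.Relation.Unary.Any using (here; there)
  open import Relation.Binary.PropositionalEquality
  open ≡-Reasoning
  open Sums using (⟦_⟧; ∑)

  private variable
    A : Set

  private
    interchange : ∀ a b u v w z → a * (u + v) + b * (w + z) ≡ (a * u + b * w) + (a * v + b * z)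
    interchange = solve-∀

  ∑-preserves-relation : (a b c : ℤ) (f g h : A → ℕ) (xs : List A) →
    (∀ x → x ∈ xs → a * + f x + b * + g x ≡ c * + h x) →
    a * + ∑ xs f + b * + ∑ xs g ≡ c * + ∑ xs h
  ∑-preserves-relation a b c f g h [] _ = begin
    a * 0ℤ + b * 0ℤ ≡⟨ cong₂ _+_ (*-zeroʳ a) (*-zeroʳ b) ⟩
    0ℤ              ≡⟨ *-zeroʳ c ⟨
    c * 0ℤ          ∎
  ∑-preserves-relation a b c f g h (x ∷ xs) rel = begin
    a * + (f x ℕ.+ ∑ xs f) + b * + (g x ℕ.+ ∑ xs g)
      ≡⟨ cong₂ (λ u v → a * u + b * v) (pos-+ (f x) _) (pos-+ (g x) _) ⟩
    a * (+ f x + + ∑ xs f) + b * (+ g x + + ∑ xs g)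
      ≡⟨ interchange a b (+ f x) _ (+ g x) _ ⟩
    (a * + f x + b * + g x) + (a * + ∑ xs f + b * + ∑ xs g)
      ≡⟨ cong₂ _+_ (rel x (here refl)) (∑-preserves-relation a b c f g h xs (λ y y∈xs → rel y (there y∈xs))) ⟩
    c * + h x + c * + ∑ xs h
      ≡⟨ *-distribˡ-+ c (+ h x) _ ⟨
    c * (+ h x + + ∑ xs h)
      ≡⟨ cong (c *_) (pos-+ (h x) _) ⟨
    c * + (h x ℕ.+ ∑ xs h) ∎

  root-relation : ∀ b (c r s : ℤ) d → c * + d ≡ (if b then r else s) →
    c * c * + (d ℕ.* d) + r * s * 1ℤ ≡ c * (r + s) * + d
  root-relation true c _ s d refl = trans (cong (λ y → c * c * y + c * + d * s * 1ℤ) (pos-* d d)) (root c (+ d) s)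
    where
    root : ∀ c y s → c * c * (y * y) + c * y * s * 1ℤ ≡ c * (c * y + s) * y
    root = solve-∀
  root-relation false c r _ d refl = trans (cong (λ y → c * c * y + r * (c * + d) * 1ℤ) (pos-* d d)) (root c (+ d) r)
    where
    root : ∀ c y r → c * c * (y * y) + r * (c * y) * 1ℤ ≡ c * (r + c * y) * y
    root = solve-∀

  split-relation : ∀ a b (c r s : ℤ) d → c * + d ≡ (if b then r else s) →
    r * + ⟦ a ∧ b ⟧ + s * + ⟦ a ∧ not b ⟧ ≡ c * + (⟦ a ⟧ ℕ.* d)
  split-relation false b c r s d _ = vanish r s c
    where
    vanish : ∀ r s c → r * 0ℤ + s * 0ℤ ≡ c * 0ℤ
    vanish = solve-∀
  split-relation true true c _ s d refl = trans (only c (+ d) s) (cong (λ y → c * + y) (sym (+-identityʳ d)))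
    where
    only : ∀ c y s → c * y * 1ℤ + s * 0ℤ ≡ c * y
    only = solve-∀
  split-relation true false c r _ d refl = trans (only c (+ d) r) (cong (λ y → c * + y) (sym (+-identityʳ d)))
    where
    only : ∀ c y r → r * 0ℤ + c * y * 1ℤ ≡ c * y
    only = solve-∀

module LinearAlgebra {m : ℕ} (F : FieldOn (Fin m)) where
  open import Data.Nat using (ℕ; zero; suc)
  open import Data.Fin.Properties using (_≟_)
  open import Data.Vec using (Vec; []; _∷_)
  open import Data.Vec.Properties using (∷-injectiveˡ; ∷-injectiveʳ)
  open import Data.List using (allFin)
  open import Data.Bool using (true; T)
  open import Data.Product using (_×_; _,_; proj₁; proj₂)
  open import Data.Sum using (_⊎_; inj₁; inj₂)
  open import Data.Empty using (⊥-elim)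
  open import Function using (_∘_)
  open import Relation.Nullary using (yes; no)
  open import Relation.Nullary.Decidable using (⌊_⌋)
  open import Relation.Binary.PropositionalEquality
  open ≡-Reasoning
  open import Algebra.Bundles using (CommutativeRing)
  open Sums using (⟦_⟧; ∑; ∑-allFin-δ)
  open FieldOn F renaming (_+_ to infixl 6 _⊕_; _*_ to infixl 7 _⊛_; -_ to ⊖_)
  open IsCommutativeRing isCommutativeRing
    using (+-assoc; +-identityˡ; +-identityʳ; *-identityˡ; *-identityʳ; *-comm; zeroˡ; zeroʳ; -‿inverseˡ; -‿inverseʳ)
  open Projective F using (normalized; dot)

  private
    commutativeRing : CommutativeRing _ _
    commutativeRing = record { isCommutativeRing = isCommutativeRing }

  open import Algebra.Solver.Ring.NaturalCoefficients.Default (CommutativeRing.commutativeSemiring commutativeRing)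
    using (solve; _:+_; _:*_; _:=_; con)

  V : ℕ → Set
  V k = Vec (Fin m) k

  zeros : ∀ k → V k
  zeros zero = []
  zeros (suc k) = 0# ∷ zeros k

  pencil : ∀ {k} → V k → V k → Fin m → V k
  pencil [] [] l = []
  pencil (g ∷ G) (h ∷ H) l = g ⊕ l ⊛ h ∷ pencil G H l

  dot-zeros : ∀ {k} (v : V k) → dot (zeros k) v ≡ 0#
  dot-zeros [] = refl
  dot-zeros (x ∷ v) = trans (cong₂ _⊕_ (zeroˡ x) (dot-zeros v)) (+-identityˡ 0#)

  dot-pencil : ∀ {k} (G H P : V k) l → dot (pencil G H l) P ≡ dot G P ⊕ l ⊛ dot H P
  dot-pencil [] [] [] l = sym (trans (cong (0# ⊕_) (zeroʳ l)) (+-identityˡ 0#))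
  dot-pencil (g ∷ G) (h ∷ H) (p ∷ P) l = begin
    (g ⊕ l ⊛ h) ⊛ p ⊕ dot (pencil G H l) P     ≡⟨ cong ((g ⊕ l ⊛ h) ⊛ p ⊕_) (dot-pencil G H P l) ⟩
    (g ⊕ l ⊛ h) ⊛ p ⊕ (dot G P ⊕ l ⊛ dot H P)  ≡⟨ distribute g h p (dot G P) (dot H P) l ⟩
    (g ⊛ p ⊕ dot G P) ⊕ l ⊛ (h ⊛ p ⊕ dot H P)  ∎
    where
    distribute : ∀ g h p a b l → (g ⊕ l ⊛ h) ⊛ p ⊕ (a ⊕ l ⊛ b) ≡ (g ⊛ p ⊕ a) ⊕ l ⊛ (h ⊛ p ⊕ b)
    distribute = solve 6 (λ g h p a b l → (g :+ l :* h) :* p :+ (a :+ l :* b) := (g :* p :+ a) :+ l :* (h :* p :+ b)) refl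

  [_≈_] : Fin m → Fin m → ℕ
  [ x ≈ y ] = ⟦ ⌊ x ≟ y ⌋ ⟧

  ≈-yes : ∀ {x y} → x ≡ y → [ x ≈ y ] ≡ 1
  ≈-yes {x} {y} x≡y with x ≟ y
  ... | yes _ = refl
  ... | no x≢y = ⊥-elim (x≢y x≡y)

  ≈-no : ∀ {x y} → x ≢ y → [ x ≈ y ] ≡ 0
  ≈-no {x} {y} x≢y with x ≟ y
  ... | yes x≡y = ⊥-elim (x≢y x≡y)
  ... | no _ = refl

  linear-equation : ∀ {a} → a ≢ 0# → ∀ d c → ∑ (allFin m) (λ x → [ d ⊕ a ⊛ x ≈ c ]) ≡ 1
  linear-equation {a} a≢0 d c = trans (∑-allFin-δ m x₀ _ (λ x x≢x₀ → ≈-no (x≢x₀ ∘ unique x))) (≈-yes solves)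
    where
    a⁻¹ : Fin m
    a⁻¹ = proj₁ (inverse a a≢0)
    x₀ : Fin m
    x₀ = a⁻¹ ⊛ (c ⊕ ⊖ d)
    regroup : ∀ d a b y → d ⊕ a ⊛ (b ⊛ y) ≡ (a ⊛ b) ⊛ y ⊕ d
    regroup = solve 4 (λ d a b y → d :+ a :* (b :* y) := (a :* b) :* y :+ d) refl
    solves : d ⊕ a ⊛ x₀ ≡ c
    solves = begin
      d ⊕ a ⊛ (a⁻¹ ⊛ (c ⊕ ⊖ d))  ≡⟨ regroup d a a⁻¹ (c ⊕ ⊖ d) ⟩
      (a ⊛ a⁻¹) ⊛ (c ⊕ ⊖ d) ⊕ d  ≡⟨ cong (λ u → u ⊛ (c ⊕ ⊖ d) ⊕ d) (proj₂ (inverse a a≢0)) ⟩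
      1# ⊛ (c ⊕ ⊖ d) ⊕ d         ≡⟨ cong (_⊕ d) (*-identityˡ (c ⊕ ⊖ d)) ⟩
      c ⊕ ⊖ d ⊕ d                ≡⟨ +-assoc c (⊖ d) d ⟩
      c ⊕ (⊖ d ⊕ d)              ≡⟨ cong (c ⊕_) (-‿inverseˡ d) ⟩
      c ⊕ 0#                     ≡⟨ +-identityʳ c ⟩
      c                          ∎
    unique : ∀ x → d ⊕ a ⊛ x ≡ c → x ≡ x₀
    unique x eq = begin
      x                                   ≡⟨ *-identityˡ x ⟨
      1# ⊛ x                              ≡⟨ cong (_⊛ x) (trans (*-comm a⁻¹ a) (proj₂ (inverse a a≢0))) ⟨
      a⁻¹ ⊛ a ⊛ x                         ≡⟨ +-identityʳ _ ⟨
      a⁻¹ ⊛ a ⊛ x ⊕ 0#                    ≡⟨ cong (a⁻¹ ⊛ a ⊛ x ⊕_) (zeroʳ a⁻¹) ⟨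
      a⁻¹ ⊛ a ⊛ x ⊕ a⁻¹ ⊛ 0#              ≡⟨ cong (λ u → a⁻¹ ⊛ a ⊛ x ⊕ a⁻¹ ⊛ u) (-‿inverseʳ d) ⟨
      a⁻¹ ⊛ a ⊛ x ⊕ a⁻¹ ⊛ (d ⊕ ⊖ d)       ≡⟨ collect a⁻¹ a x d (⊖ d) ⟩
      a⁻¹ ⊛ ((d ⊕ a ⊛ x) ⊕ ⊖ d)           ≡⟨ cong (λ u → a⁻¹ ⊛ (u ⊕ ⊖ d)) eq ⟩
      a⁻¹ ⊛ (c ⊕ ⊖ d)                     ∎
      where
      collect : ∀ b a x d y → b ⊛ a ⊛ x ⊕ b ⊛ (d ⊕ y) ≡ b ⊛ ((d ⊕ a ⊛ x) ⊕ y)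
      collect = solve 5 (λ b a x d y → b :* a :* x :+ b :* (d :+ y) := b :* ((d :+ a :* x) :+ y)) refl

  normalized-cons : ∀ {k} x (v : V k) → T (normalized (x ∷ v)) → x ≡ 0# × T (normalized v) ⊎ x ≡ 1#
  normalized-cons x v n with x ≟ 0# | x ≟ 1# | normalized v
  ... | _       | yes x≡1 | _    = inj₂ x≡1
  ... | yes x≡0 | no _    | true = inj₁ (x≡0 , _)

  normalized⇒nonzero : ∀ {k} (v : V k) → T (normalized v) → v ≢ zeros k
  normalized⇒nonzero (x ∷ v) n refl with normalized-cons x v n
  ... | inj₁ (_ , n′) = normalized⇒nonzero v n′ refl
  ... | inj₂ 0≡1 = 0≢1 0≡1

  pencil-zero : ∀ {k} (G H : V k) → pencil G H 0# ≡ G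
  pencil-zero [] [] = refl
  pencil-zero (g ∷ G) (h ∷ H) = cong₂ _∷_ (trans (cong (g ⊕_) (zeroˡ h)) (+-identityʳ g)) (pencil-zero G H)

  pencil-minus-one : ∀ {k} (G H : V k) l → 1# ⊕ l ≡ 0# → pencil G H l ≡ zeros k → G ≡ H
  pencil-minus-one [] [] l _ _ = refl
  pencil-minus-one (g ∷ G) (h ∷ H) l 1+l≡0 eq = cong₂ _∷_ g≡h (pencil-minus-one G H l 1+l≡0 (∷-injectiveʳ eq))
    where
    regroup : ∀ g l h → g ⊕ (1# ⊕ l) ⊛ h ≡ (g ⊕ l ⊛ h) ⊕ 1# ⊛ h
    regroup = solve 3 (λ g l h → g :+ (con 1 :+ l) :* h := (g :+ l :* h) :+ con 1 :* h) refl
    g≡h : g ≡ h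
    g≡h = begin
      g                     ≡⟨ +-identityʳ g ⟨
      g ⊕ 0#                ≡⟨ cong (g ⊕_) (zeroˡ h) ⟨
      g ⊕ 0# ⊛ h            ≡⟨ cong (λ u → g ⊕ u ⊛ h) 1+l≡0 ⟨
      g ⊕ (1# ⊕ l) ⊛ h      ≡⟨ regroup g l h ⟩
      (g ⊕ l ⊛ h) ⊕ 1# ⊛ h  ≡⟨ cong₂ _⊕_ (∷-injectiveˡ eq) (*-identityˡ h) ⟩
      0# ⊕ h                ≡⟨ +-identityˡ h ⟩
      h                     ∎

  pencil-nonzero : ∀ {k} (G H : V k) l → T (normalized G) → T (normalized H) → G ≢ H → pencil G H l ≢ zeros k
  pencil-nonzero (g ∷ G) (h ∷ H) l nG nH G≢H eq
    with normalized-cons g G nG | normalized-cons h H nH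
  ... | inj₁ (refl , nG′) | inj₁ (refl , nH′) =
    pencil-nonzero G H l nG′ nH′ (G≢H ∘ cong (0# ∷_)) (∷-injectiveʳ eq)
  ... | inj₂ refl | inj₁ (refl , _) =
    0≢1 (sym (trans (sym (trans (cong (1# ⊕_) (zeroʳ l)) (+-identityʳ 1#))) (∷-injectiveˡ eq)))
  ... | inj₁ (refl , nG′) | inj₂ refl =
    normalized⇒nonzero G nG′ (trans (sym (pencil-zero G H)) (subst (λ u → pencil G H u ≡ zeros _) l≡0 (∷-injectiveʳ eq)))
    where
    l≡0 : l ≡ 0#
    l≡0 = trans (sym (trans (+-identityˡ (l ⊛ 1#)) (*-identityʳ l))) (∷-injectiveˡ eq)
  ... | inj₂ refl | inj₂ refl =
    G≢H (cong (1# ∷_) (pencil-minus-one G H l 1+l≡0 (∷-injectiveʳ eq)))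
    where
    1+l≡0 : 1# ⊕ l ≡ 0#
    1+l≡0 = trans (cong (1# ⊕_) (sym (*-identityʳ l))) (∷-injectiveˡ eq)

module Counting {m : ℕ} (F : FieldOn (Fin m)) where
  open FieldOn F renaming (_+_ to infixl 6 _⊕_; _*_ to infixl 7 _⊛_)
  module R = IsCommutativeRing isCommutativeRing
  open Projective F
  open LinearAlgebra F
  open Sums
  open import Data.Nat using (ℕ; zero; suc; _+_; _*_; _^_)
  open import Data.Nat.Properties hiding (_≟_)
  open import Data.Nat.Tactic.RingSolver using (solve-∀)
  open import Data.Fin.Properties using (_≟_; nonZeroIndex)
  open import Data.Vec using (Vec; []; _∷_)
  open import Data.Vec.Properties using (≡-dec)
  open import Data.List using (List; allFin; length)
  open import Data.Bool using (true; false; T)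
  open import Data.Empty using (⊥-elim)
  open import Function using (_∘_)
  open import Relation.Nullary using (yes; no)
  open import Relation.Binary.PropositionalEquality
  open ≡-Reasoning

  -- θ k = |PG(k - 1, m)|, the number of normalized vectors of length k.
  θ : ℕ → ℕ
  θ zero = 0
  θ (suc k) = θ k + m ^ k

  θ-suc : ∀ k → θ k + m ^ k ≡ 1 + m * θ k
  θ-suc zero = cong suc (sym (*-zeroʳ m))
  θ-suc (suc k) = begin
    θ k + m ^ k + m * m ^ k    ≡⟨ cong (_+ m * m ^ k) (θ-suc k) ⟩
    1 + m * θ k + m * m ^ k    ≡⟨ +-assoc 1 (m * θ k) _ ⟩
    1 + (m * θ k + m * m ^ k)  ≡⟨ cong (1 +_) (*-distribˡ-+ m (θ k) (m ^ k)) ⟨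
    1 + m * (θ k + m ^ k)      ∎

  ν : ∀ {k} → V k → ℕ
  ν v = ⟦ normalized v ⟧

  ν-cons : ∀ {k} x (v : V k) → ν (x ∷ v) ≡ [ x ≈ 0# ] * ν v + [ x ≈ 1# ]
  ν-cons x v with x ≟ 0# | x ≟ 1# | normalized v
  ... | yes refl | yes 0≡1 | _     = ⊥-elim (0≢1 0≡1)
  ... | yes _    | no _    | true  = refl
  ... | yes _    | no _    | false = refl
  ... | no _     | yes _   | _     = refl
  ... | no _     | no _    | _     = refl

  ∑-normalized-split : ∀ k (g : V (suc k) → ℕ) →
    ∑ (allVecs m (suc k)) (λ P → ν P * g P)
      ≡ ∑ (allVecs m k) (λ v → ν v * g (0# ∷ v)) + ∑ (allVecs m k) (λ v → g (1# ∷ v))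
  ∑-normalized-split k g = begin
    ∑ (allVecs m (suc k)) (λ P → ν P * g P)
      ≡⟨ ∑-allVecs-suc m k _ ⟩
    ∑ (allFin m) (λ x → ∑ (allVecs m k) (λ v → ν (x ∷ v) * g (x ∷ v)))
      ≡⟨ ∑-cong (allFin m) split-head ⟩
    ∑ (allFin m) (λ x → [ x ≈ 0# ] * A x + [ x ≈ 1# ] * B x)
      ≡⟨ ∑-+ (allFin m) _ _ ⟩
    ∑ (allFin m) (λ x → [ x ≈ 0# ] * A x) + ∑ (allFin m) (λ x → [ x ≈ 1# ] * B x)
      ≡⟨ cong₂ _+_ (∑-allFin-δ m 0# _ (λ x x≢0 → cong (_* A x) (≈-no x≢0)))
                   (∑-allFin-δ m 1# _ (λ x x≢1 → cong (_* B x) (≈-no x≢1))) ⟩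
    [ 0# ≈ 0# ] * A 0# + [ 1# ≈ 1# ] * B 1#
      ≡⟨ cong₂ (λ a b → a * A 0# + b * B 1#) (≈-yes {x = 0#} refl) (≈-yes {x = 1#} refl) ⟩
    1 * A 0# + 1 * B 1#
      ≡⟨ cong₂ _+_ (*-identityˡ (A 0#)) (*-identityˡ (B 1#)) ⟩
    A 0# + B 1# ∎
    where
    A B : Fin m → ℕ
    A x = ∑ (allVecs m k) (λ v → ν v * g (x ∷ v))
    B x = ∑ (allVecs m k) (λ v → g (x ∷ v))
    distrib : ∀ a n b c → (a * n + b) * c ≡ a * (n * c) + b * c
    distrib = solve-∀
    split-head : ∀ x → ∑ (allVecs m k) (λ v → ν (x ∷ v) * g (x ∷ v)) ≡ [ x ≈ 0# ] * A x + [ x ≈ 1# ] * B x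
    split-head x = begin
      ∑ (allVecs m k) (λ v → ν (x ∷ v) * g (x ∷ v))
        ≡⟨ ∑-cong (allVecs m k) (λ v → trans (cong (_* g (x ∷ v)) (ν-cons x v)) (distrib [ x ≈ 0# ] (ν v) _ _)) ⟩
      ∑ (allVecs m k) (λ v → [ x ≈ 0# ] * (ν v * g (x ∷ v)) + [ x ≈ 1# ] * g (x ∷ v))
        ≡⟨ ∑-+ (allVecs m k) _ _ ⟩
      ∑ (allVecs m k) (λ v → [ x ≈ 0# ] * (ν v * g (x ∷ v))) + ∑ (allVecs m k) (λ v → [ x ≈ 1# ] * g (x ∷ v))
        ≡⟨ cong₂ _+_ (∑-*ˡ (allVecs m k) [ x ≈ 0# ] _) (∑-*ˡ (allVecs m k) [ x ≈ 1# ] (λ v → g (x ∷ v))) ⟩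
      [ x ≈ 0# ] * A x + [ x ≈ 1# ] * B x ∎

  ∑-normalized : ∀ k → ∑ (allVecs m k) (λ v → ν v * 1) ≡ θ k
  ∑-normalized zero = refl
  ∑-normalized (suc k) = begin
    ∑ (allVecs m (suc k)) (λ v → ν v * 1)                          ≡⟨ ∑-normalized-split k _ ⟩
    ∑ (allVecs m k) (λ v → ν v * 1) + ∑ (allVecs m k) (λ _ → 1)    ≡⟨ cong₂ _+_ (∑-normalized k) (∑-allVecs-const m k 1) ⟩
    θ k + m ^ k * 1                                                ≡⟨ cong (θ k +_) (*-identityʳ (m ^ k)) ⟩
    θ k + m ^ k                                                    ∎

  affine-solutions : ∀ k (H : V (suc k)) d c → H ≢ zeros (suc k) →
    ∑ (allVecs m (suc k)) (λ v → [ d ⊕ dot H v ≈ c ]) ≡ m ^ k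
  affine-solutions k (h ∷ H) d c hH≢0 with ≡-dec _≟_ H (zeros k)
  ... | yes refl = begin
    ∑ (allVecs m (suc k)) (λ v → [ d ⊕ dot (h ∷ zeros k) v ≈ c ])
      ≡⟨ ∑-allVecs-suc m k _ ⟩
    ∑ (allFin m) (λ x → ∑ (allVecs m k) (λ v → [ d ⊕ (h ⊛ x ⊕ dot (zeros k) v) ≈ c ]))
      ≡⟨ ∑-cong (allFin m) (λ x → ∑-cong (allVecs m k) (λ v → cong (λ u → [ d ⊕ u ≈ c ])
           (trans (cong (h ⊛ x ⊕_) (dot-zeros v)) (R.+-identityʳ (h ⊛ x))))) ⟩
    ∑ (allFin m) (λ x → ∑ (allVecs m k) (λ _ → [ d ⊕ h ⊛ x ≈ c ]))
      ≡⟨ ∑-cong (allFin m) (λ x → ∑-allVecs-const m k _) ⟩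
    ∑ (allFin m) (λ x → m ^ k * [ d ⊕ h ⊛ x ≈ c ])
      ≡⟨ ∑-*ˡ (allFin m) (m ^ k) _ ⟩
    m ^ k * ∑ (allFin m) (λ x → [ d ⊕ h ⊛ x ≈ c ])
      ≡⟨ cong (m ^ k *_) (linear-equation (λ h≡0 → hH≢0 (cong (_∷ zeros k) h≡0)) d c) ⟩
    m ^ k * 1
      ≡⟨ *-identityʳ (m ^ k) ⟩
    m ^ k ∎
  affine-solutions zero (h ∷ []) d c _ | no []≢[] = ⊥-elim ([]≢[] refl)
  affine-solutions (suc k) (h ∷ H) d c _ | no H≢0 = begin
    ∑ (allVecs m (suc (suc k))) (λ v → [ d ⊕ dot (h ∷ H) v ≈ c ])
      ≡⟨ ∑-allVecs-suc m (suc k) _ ⟩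
    ∑ (allFin m) (λ x → ∑ (allVecs m (suc k)) (λ v → [ d ⊕ (h ⊛ x ⊕ dot H v) ≈ c ]))
      ≡⟨ ∑-cong (allFin m) (λ x → ∑-cong (allVecs m (suc k)) (λ v →
           cong (λ u → [ u ≈ c ]) (sym (R.+-assoc d (h ⊛ x) _)))) ⟩
    ∑ (allFin m) (λ x → ∑ (allVecs m (suc k)) (λ v → [ (d ⊕ h ⊛ x) ⊕ dot H v ≈ c ]))
      ≡⟨ ∑-cong (allFin m) (λ x → affine-solutions k H (d ⊕ h ⊛ x) c H≢0) ⟩
    ∑ (allFin m) (λ _ → m ^ k)
      ≡⟨ ∑-allFin-const m (m ^ k) ⟩
    m * m ^ k ∎

  incident-cons : ∀ {k} h (H : V k) →
    ∑ (allVecs m (suc k)) (λ P → ν P * ⟦ incident (h ∷ H) P ⟧)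
      ≡ ∑ (allVecs m k) (λ v → ν v * ⟦ incident H v ⟧) + ∑ (allVecs m k) (λ v → [ h ⊛ 1# ⊕ dot H v ≈ 0# ])
  incident-cons {k} h H = begin
    ∑ (allVecs m (suc k)) (λ P → ν P * ⟦ incident (h ∷ H) P ⟧)
      ≡⟨ ∑-normalized-split k _ ⟩
    ∑ (allVecs m k) (λ v → ν v * [ h ⊛ 0# ⊕ dot H v ≈ 0# ]) + ∑ (allVecs m k) (λ v → [ h ⊛ 1# ⊕ dot H v ≈ 0# ])
      ≡⟨ cong (_+ ∑ (allVecs m k) (λ v → [ h ⊛ 1# ⊕ dot H v ≈ 0# ])) (∑-cong (allVecs m k) (λ v → cong (λ u → ν v * [ u ≈ 0# ])
           (trans (cong (_⊕ dot H v) (R.zeroʳ h)) (R.+-identityˡ (dot H v))))) ⟩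
    ∑ (allVecs m k) (λ v → ν v * ⟦ incident H v ⟧) + ∑ (allVecs m k) (λ v → [ h ⊛ 1# ⊕ dot H v ≈ 0# ]) ∎

  points-on-hyperplane : ∀ k (H : V (suc k)) → H ≢ zeros (suc k) →
    ∑ (allVecs m (suc k)) (λ P → ν P * ⟦ incident H P ⟧) ≡ θ k
  points-on-hyperplane k (h ∷ H) hH≢0 with ≡-dec _≟_ H (zeros k)
  ... | yes refl = begin
    ∑ (allVecs m (suc k)) (λ P → ν P * ⟦ incident (h ∷ zeros k) P ⟧)
      ≡⟨ incident-cons h (zeros k) ⟩
    ∑ (allVecs m k) (λ v → ν v * ⟦ incident (zeros k) v ⟧) + ∑ (allVecs m k) (λ v → [ h ⊛ 1# ⊕ dot (zeros k) v ≈ 0# ])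
      ≡⟨ cong₂ _+_ (∑-cong (allVecs m k) (λ v → cong (ν v *_) (≈-yes (dot-zeros v))))
                   (∑-cong (allVecs m k) (λ v → ≈-no (h≢0 ∘ on-axis v))) ⟩
    ∑ (allVecs m k) (λ v → ν v * 1) + ∑ (allVecs m k) (λ _ → 0)
      ≡⟨ cong₂ _+_ (∑-normalized k) (∑-allVecs-const m k 0) ⟩
    θ k + m ^ k * 0
      ≡⟨ cong (θ k +_) (*-zeroʳ (m ^ k)) ⟩
    θ k + 0
      ≡⟨ +-identityʳ (θ k) ⟩
    θ k ∎
    where
    h≢0 : h ≢ 0#
    h≢0 h≡0 = hH≢0 (cong (_∷ zeros k) h≡0)
    on-axis : ∀ v → h ⊛ 1# ⊕ dot (zeros k) v ≡ 0# → h ≡ 0#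
    on-axis v eq = trans (sym (trans (cong (h ⊛ 1# ⊕_) (dot-zeros v)) (trans (R.+-identityʳ _) (R.*-identityʳ h)))) eq
  points-on-hyperplane zero (h ∷ []) _ | no []≢[] = ⊥-elim ([]≢[] refl)
  points-on-hyperplane (suc k) (h ∷ H) _ | no H≢0 =
    trans (incident-cons h H) (cong₂ _+_ (points-on-hyperplane k H H≢0) (affine-solutions k H (h ⊛ 1#) 0# H≢0))

  ∑-points : ∀ s (f : V (suc s) → ℕ) → ∑ (points s) f ≡ ∑ (allVecs m (suc s)) (λ P → ν P * f P)
  ∑-points s = ∑-filterᵇ normalized (allVecs m (suc s))

  length-points : ∀ s → length (points s) ≡ θ (suc s)
  length-points s = begin
    length (points s)                          ≡⟨ *-identityʳ _ ⟨
    length (points s) * 1                      ≡⟨ ∑-const (points s) 1 ⟨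
    ∑ (points s) (λ _ → 1)                     ≡⟨ ∑-points s _ ⟩
    ∑ (allVecs m (suc s)) (λ P → ν P * 1)      ≡⟨ ∑-normalized (suc s) ⟩
    θ (suc s)                                  ∎

  hyperplane-size : ∀ s (H : V (suc s)) → H ≢ zeros (suc s) → ∑ (points s) (λ P → ⟦ incident H P ⟧) ≡ θ s
  hyperplane-size s H H≢0 = trans (∑-points s _) (points-on-hyperplane s H H≢0)

  -- With a = H·P and b = G·P: a point off H lies on exactly one G + l H; a point on H lies on all of
  -- them if it is on G, and on none otherwise.
  pencil-covers : ∀ b a → ∑ (allFin m) (λ l → [ b ⊕ l ⊛ a ≈ 0# ]) + [ a ≈ 0# ] ≡ 1 + m * ([ b ≈ 0# ] * [ a ≈ 0# ])
  pencil-covers b a with a ≟ 0#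
  ... | yes refl = begin
    ∑ (allFin m) (λ l → [ b ⊕ l ⊛ 0# ≈ 0# ]) + 1
      ≡⟨ cong (_+ 1) (∑-cong (allFin m) (λ l →
           cong (λ u → [ u ≈ 0# ]) (trans (cong (b ⊕_) (R.zeroʳ l)) (R.+-identityʳ b)))) ⟩
    ∑ (allFin m) (λ _ → [ b ≈ 0# ]) + 1
      ≡⟨ cong (_+ 1) (∑-allFin-const m _) ⟩
    m * [ b ≈ 0# ] + 1
      ≡⟨ +-comm _ 1 ⟩
    1 + m * [ b ≈ 0# ]
      ≡⟨ cong (λ u → 1 + m * u) (*-identityʳ [ b ≈ 0# ]) ⟨
    1 + m * ([ b ≈ 0# ] * 1) ∎
  ... | no a≢0 = begin
    ∑ (allFin m) (λ l → [ b ⊕ l ⊛ a ≈ 0# ]) + 0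
      ≡⟨ +-identityʳ _ ⟩
    ∑ (allFin m) (λ l → [ b ⊕ l ⊛ a ≈ 0# ])
      ≡⟨ ∑-cong (allFin m) (λ l → cong (λ u → [ b ⊕ u ≈ 0# ]) (R.*-comm l a)) ⟩
    ∑ (allFin m) (λ l → [ b ⊕ a ⊛ l ≈ 0# ])
      ≡⟨ linear-equation a≢0 b 0# ⟩
    1
      ≡⟨ cong (1 +_) (*-zeroʳ m) ⟨
    1 + m * 0
      ≡⟨ cong (λ u → 1 + m * u) (*-zeroʳ [ b ≈ 0# ]) ⟨
    1 + m * ([ b ≈ 0# ] * 0) ∎

  pencil-identity : ∀ s (G H : V (suc s)) → T (normalized G) → T (normalized H) → G ≢ H →
    m * θ s + θ s ≡ θ (suc s) + m * ∑ (points s) (λ P → ⟦ incident G P ⟧ * ⟦ incident H P ⟧)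
  pencil-identity s G H nG nH G≢H = begin
    m * θ s + θ s
      ≡⟨ cong (_+ θ s) (∑-allFin-const m (θ s)) ⟨
    ∑ (allFin m) (λ _ → θ s) + θ s
      ≡⟨ cong₂ _+_ (∑-cong (allFin m) (λ l → hyperplane-size s (pencil G H l) (pencil-nonzero G H l nG nH G≢H)))
                   (hyperplane-size s H (normalized⇒nonzero H nH)) ⟨
    ∑ (allFin m) (λ l → ∑ Ps (λ P → ⟦ incident (pencil G H l) P ⟧)) + ∑ Ps (λ P → ⟦ incident H P ⟧)
      ≡⟨ cong (_+ ∑ Ps (λ P → ⟦ incident H P ⟧)) (∑-swap (allFin m) Ps _) ⟩
    ∑ Ps (λ P → ∑ (allFin m) (λ l → ⟦ incident (pencil G H l) P ⟧)) + ∑ Ps (λ P → ⟦ incident H P ⟧)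
      ≡⟨ ∑-+ Ps _ _ ⟨
    ∑ Ps (λ P → ∑ (allFin m) (λ l → ⟦ incident (pencil G H l) P ⟧) + ⟦ incident H P ⟧)
      ≡⟨ ∑-cong Ps on-pencil ⟩
    ∑ Ps (λ P → 1 + m * (⟦ incident G P ⟧ * ⟦ incident H P ⟧))
      ≡⟨ ∑-+ Ps _ _ ⟩
    ∑ Ps (λ _ → 1) + ∑ Ps (λ P → m * (⟦ incident G P ⟧ * ⟦ incident H P ⟧))
      ≡⟨ cong₂ _+_ (trans (∑-const Ps 1) (trans (*-identityʳ _) (length-points s))) (∑-*ˡ Ps m _) ⟩
    θ (suc s) + m * ∑ Ps (λ P → ⟦ incident G P ⟧ * ⟦ incident H P ⟧) ∎
    where
    Ps : List (V (suc s))
    Ps = points s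
    on-pencil : ∀ P → ∑ (allFin m) (λ l → ⟦ incident (pencil G H l) P ⟧) + ⟦ incident H P ⟧
                        ≡ 1 + m * (⟦ incident G P ⟧ * ⟦ incident H P ⟧)
    on-pencil P = trans (cong (_+ ⟦ incident H P ⟧) (∑-cong (allFin m) (λ l → cong (λ u → [ u ≈ 0# ]) (dot-pencil G H P l))))
                        (pencil-covers (dot G P) (dot H P))

  intersection-size : ∀ t (G H : V (suc (suc t))) → T (normalized G) → T (normalized H) → G ≢ H →
    ∑ (points (suc t)) (λ P → ⟦ incident G P ⟧ * ⟦ incident H P ⟧) ≡ θ t
  intersection-size t G H nG nH G≢H = sym (*-cancelˡ-≡ (θ t) I m {{nonZeroIndex 0#}} (+-cancelʳ-≡ _ _ _ (begin
    m * θ t + θ (suc (suc t))         ≡⟨ regroup m (θ t) (m ^ t) ⟩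
    m * θ (suc t) + θ (suc t)         ≡⟨ pencil-identity (suc t) G H nG nH G≢H ⟩
    θ (suc (suc t)) + m * I           ≡⟨ +-comm _ (m * I) ⟩
    m * I + θ (suc (suc t))           ∎)))
    where
    I : ℕ
    I = ∑ (points (suc t)) (λ P → ⟦ incident G P ⟧ * ⟦ incident H P ⟧)
    regroup : ∀ m a b → m * a + (a + b + m * b) ≡ m * (a + b) + (a + b)
    regroup = solve-∀

module DoubleCounting {m : ℕ} (F : FieldOn (Fin m)) (t : ℕ) (Ω : Vec (Fin m) (suc (suc t)) → Bool) where
  open Projective F
  open LinearAlgebra F using (V; normalized⇒nonzero)
  open Counting F
  open Sums
  open import Data.Nat using (ℕ; suc; _+_; _*_; _^_)
  open import Data.Nat.Properties
  open import Data.Fin.Properties using () renaming (_≟_ to _≟ᶠ_)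
  open import Data.Vec.Properties using (≡-dec)
  open import Data.List using (List; length; filterᵇ)
  open import Data.List.Membership.Propositional using (_∈_)
  open import Data.List.Membership.Propositional.Properties using (∈-filter⁻)
  open import Data.Bool using (T; _∧_)
  open import Data.Bool.Properties using (T?)
  open import Data.Product using (_×_; proj₁; proj₂)
  open import Function using (_∘_)
  open import Data.Empty using (⊥-elim)
  open import Relation.Nullary using (yes; no)
  open import Relation.Nullary.Decidable using (⌊_⌋; fromWitness)
  open import Relation.Binary.PropositionalEquality
  open ≡-Reasoning

  private
    s : ℕ
    s = suc t

  Ωs : List (V (suc s))
  Ωs = filterᵇ Ω (hyperplanes s)

  n : ℕ
  n = length Ωs

  deg : V (suc s) → ℕ
  deg = degree s Ω

  ∈-points⁻ : ∀ {P} → P ∈ points s → T (normalized P)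
  ∈-points⁻ = proj₂ ∘ ∈-filter⁻ (T? ∘ normalized) {xs = allVecs m (suc s)}

  ∈-Ωs⁻ : ∀ {H} → H ∈ Ωs → H ∈ hyperplanes s × T (Ω H)
  ∈-Ωs⁻ = ∈-filter⁻ (T? ∘ Ω) {xs = hyperplanes s}

  ∑-Ωs : (f : V (suc s) → ℕ) → ∑ Ωs f ≡ ∑ (hyperplanes s) (λ H → ⟦ Ω H ⟧ * f H)
  ∑-Ωs = ∑-filterᵇ Ω (hyperplanes s)

  degree-as-sum : ∀ P → deg P ≡ ∑ Ωs (λ H → ⟦ incident H P ⟧)
  degree-as-sum P = begin
    deg P                                                      ≡⟨ length-filterᵇ _ (hyperplanes s) ⟩
    ∑ (hyperplanes s) (λ H → ⟦ Ω H ∧ incident H P ⟧)           ≡⟨ ∑-cong (hyperplanes s) (λ H → ⟦∧⟧ (Ω H) _) ⟩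
    ∑ (hyperplanes s) (λ H → ⟦ Ω H ⟧ * ⟦ incident H P ⟧)       ≡⟨ ∑-Ωs _ ⟨
    ∑ Ωs (λ H → ⟦ incident H P ⟧)                              ∎

  double-count : (w : V (suc s) → ℕ) →
    ∑ (points s) (λ P → w P * deg P) ≡ ∑ Ωs (λ H → ∑ (points s) (λ P → w P * ⟦ incident H P ⟧))
  double-count w = begin
    ∑ (points s) (λ P → w P * deg P)
      ≡⟨ ∑-cong (points s) (λ P → trans (cong (w P *_) (degree-as-sum P)) (sym (∑-*ˡ Ωs (w P) _))) ⟩
    ∑ (points s) (λ P → ∑ Ωs (λ H → w P * ⟦ incident H P ⟧))
      ≡⟨ ∑-swap (points s) Ωs _ ⟩
    ∑ Ωs (λ H → ∑ (points s) (λ P → w P * ⟦ incident H P ⟧)) ∎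

  ∑-degree : ∑ (points s) deg ≡ n * θ s
  ∑-degree = begin
    ∑ (points s) deg                                             ≡⟨ ∑-cong (points s) (λ P → *-identityˡ (deg P)) ⟨
    ∑ (points s) (λ P → 1 * deg P)                               ≡⟨ double-count (λ _ → 1) ⟩
    ∑ Ωs (λ H → ∑ (points s) (λ P → 1 * ⟦ incident H P ⟧))       ≡⟨ ∑-congᴹ Ωs on-H ⟩
    ∑ Ωs (λ _ → θ s)                                             ≡⟨ ∑-const Ωs (θ s) ⟩
    n * θ s                                                      ∎
    where
    on-H : ∀ H → H ∈ Ωs → ∑ (points s) (λ P → 1 * ⟦ incident H P ⟧) ≡ θ s
    on-H H H∈Ωs = trans (∑-cong (points s) (λ P → *-identityˡ _))
                        (hyperplane-size s H (normalized⇒nonzero H (∈-points⁻ (proj₁ (∈-Ωs⁻ H∈Ωs)))))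

  [_≡ᵛ_] : V (suc s) → V (suc s) → ℕ
  [ G ≡ᵛ H ] = ⟦ ⌊ ≡-dec _≟ᶠ_ G H ⌋ ⟧

  multiplicity-in-Ωs : ∀ {H₀} → H₀ ∈ hyperplanes s → T (Ω H₀) → ∑ Ωs (λ H → [ H ≡ᵛ H₀ ]) ≡ 1
  multiplicity-in-Ωs {H₀} H₀∈ ΩH₀ = begin
    ∑ Ωs (λ H → [ H ≡ᵛ H₀ ])                                          ≡⟨ ∑-Ωs _ ⟩
    ∑ (hyperplanes s) (λ H → ⟦ Ω H ⟧ * [ H ≡ᵛ H₀ ])                   ≡⟨ ∑-points s _ ⟩
    ∑ (allVecs m (suc s)) (λ H → ν H * (⟦ Ω H ⟧ * [ H ≡ᵛ H₀ ]))       ≡⟨ ∑-allVecs-δ m (suc s) H₀ _ off ⟩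
    ν H₀ * (⟦ Ω H₀ ⟧ * [ H₀ ≡ᵛ H₀ ])                                  ≡⟨ on ⟩
    1                                                                 ∎
    where
    off : ∀ H → H ≢ H₀ → ν H * (⟦ Ω H ⟧ * [ H ≡ᵛ H₀ ]) ≡ 0
    off H H≢H₀ with ≡-dec _≟ᶠ_ H H₀
    ... | yes H≡H₀ = ⊥-elim (H≢H₀ H≡H₀)
    ... | no _ = trans (cong (ν H *_) (*-zeroʳ ⟦ Ω H ⟧)) (*-zeroʳ (ν H))
    on : ν H₀ * (⟦ Ω H₀ ⟧ * [ H₀ ≡ᵛ H₀ ]) ≡ 1
    on = cong₂ _*_ (T⇒⟦⟧≡1 (∈-points⁻ H₀∈)) (cong₂ _*_ (T⇒⟦⟧≡1 ΩH₀) (T⇒⟦⟧≡1 (fromWitness refl)))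

  ∑-degree-on : ∀ {H₀} → H₀ ∈ hyperplanes s → T (Ω H₀) →
    ∑ (points s) (λ P → ⟦ incident H₀ P ⟧ * deg P) ≡ n * θ t + m ^ t
  ∑-degree-on {H₀} H₀∈ ΩH₀ = begin
    ∑ (points s) (λ P → ⟦ incident H₀ P ⟧ * deg P)
      ≡⟨ double-count (λ P → ⟦ incident H₀ P ⟧) ⟩
    ∑ Ωs (λ H → ∑ (points s) (λ P → ⟦ incident H₀ P ⟧ * ⟦ incident H P ⟧))
      ≡⟨ ∑-congᴹ Ωs meet ⟩
    ∑ Ωs (λ H → θ t + m ^ t * [ H ≡ᵛ H₀ ])
      ≡⟨ ∑-+ Ωs _ _ ⟩
    ∑ Ωs (λ _ → θ t) + ∑ Ωs (λ H → m ^ t * [ H ≡ᵛ H₀ ])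
      ≡⟨ cong₂ _+_ (∑-const Ωs (θ t)) (trans (∑-*ˡ Ωs (m ^ t) _) (cong (m ^ t *_) (multiplicity-in-Ωs H₀∈ ΩH₀))) ⟩
    n * θ t + m ^ t * 1
      ≡⟨ cong (n * θ t +_) (*-identityʳ (m ^ t)) ⟩
    n * θ t + m ^ t ∎
    where
    meet : ∀ H → H ∈ Ωs →
      ∑ (points s) (λ P → ⟦ incident H₀ P ⟧ * ⟦ incident H P ⟧) ≡ θ t + m ^ t * [ H ≡ᵛ H₀ ]
    meet H H∈Ωs with ≡-dec _≟ᶠ_ H H₀
    ... | yes refl = begin
      ∑ (points s) (λ P → ⟦ incident H P ⟧ * ⟦ incident H P ⟧)   ≡⟨ ∑-cong (points s) (λ P → ⟦⟧-idem (incident H P)) ⟩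
      ∑ (points s) (λ P → ⟦ incident H P ⟧)                      ≡⟨ hyperplane-size s H (normalized⇒nonzero H (∈-points⁻ H₀∈)) ⟩
      θ t + m ^ t                                                ≡⟨ cong (θ t +_) (*-identityʳ (m ^ t)) ⟨
      θ t + m ^ t * 1                                            ∎
    ... | no H≢H₀ = begin
      ∑ (points s) (λ P → ⟦ incident H₀ P ⟧ * ⟦ incident H P ⟧)
        ≡⟨ intersection-size t H₀ H (∈-points⁻ H₀∈) (∈-points⁻ (proj₁ (∈-Ωs⁻ H∈Ωs))) (H≢H₀ ∘ sym) ⟩
      θ t          ≡⟨ +-identityʳ (θ t) ⟨
      θ t + 0      ≡⟨ cong (θ t +_) (*-zeroʳ (m ^ t)) ⟨
      θ t + m ^ t * 0 ∎

  ∑-degree² : ∑ (points s) (λ P → deg P * deg P) ≡ n * (n * θ t + m ^ t)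
  ∑-degree² = begin
    ∑ (points s) (λ P → deg P * deg P)                         ≡⟨ double-count deg ⟩
    ∑ Ωs (λ H → ∑ (points s) (λ P → deg P * ⟦ incident H P ⟧)) ≡⟨ ∑-congᴹ Ωs on-H ⟩
    ∑ Ωs (λ _ → n * θ t + m ^ t)                               ≡⟨ ∑-const Ωs _ ⟩
    n * (n * θ t + m ^ t)                                      ∎
    where
    on-H : ∀ H → H ∈ Ωs → ∑ (points s) (λ P → deg P * ⟦ incident H P ⟧) ≡ n * θ t + m ^ t
    on-H H H∈Ωs = trans (∑-cong (points s) (λ P → *-comm (deg P) _))
                        (∑-degree-on (proj₁ (∈-Ωs⁻ H∈Ωs)) (proj₂ (∈-Ωs⁻ H∈Ωs)))

-- Stated in full because the ring solver does not unfold definitions; in BlackPoints' notation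
-- c = q + 1, K = q² - 1, β = q x (x - e), ω = x (q x + e).  They hold only for e = ±1.
module SignedIdentities where
  open import Data.Integer using (ℤ; 1ℤ; -1ℤ; _+_; _-_; _*_)
  open import Data.Integer.Tactic.RingSolver using (solve-∀)
  open import Data.Sum using (_⊎_; inj₁; inj₂)
  open import Relation.Binary.PropositionalEquality using (_≡_; refl)

  IsSign : ℤ → Set
  IsSign e = e ≡ 1ℤ ⊎ e ≡ -1ℤ

  factorisation : ∀ {e} → IsSign e → ∀ q x n t →
    (q * q - 1ℤ) * ((q + 1ℤ) * (q + 1ℤ) * (n * (n * t + x * x)) + q * x * (x - e) * (x * (q * x + e)) * (t + x * x + q * q * (x * x))
                    - (q + 1ℤ) * (q * x * (x - e) + x * (q * x + e)) * (n * (t + x * x)))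
      ≡ (x - e) * (((q + 1ℤ) * n - q * x * (q * q * x - e)) * ((q + 1ℤ) * (x + e) * n - x * (q * q * x + e) * (q * x + e)))
        + ((q * q - 1ℤ) * t - (x * x - 1ℤ)) * (((q + 1ℤ) * n - q * x * (x - e)) * ((q + 1ℤ) * n - x * (q * x + e)))
  factorisation (inj₁ refl) = solve-∀
  factorisation (inj₂ refl) = solve-∀

  second-factor-remainder : ∀ {e} → IsSign e → ∀ q x n →
    (q * q - 1ℤ) * (q - 1ℤ)
      ≡ e * (q * q * q * (x * x) + e * (q * q + q - q * q * q) * x + (q * q - 1ℤ) * (q - 1ℤ) - (q + 1ℤ) * n) * (x + e)
        + e * ((q + 1ℤ) * (x + e) * n - x * (q * q * x + e) * (q * x + e))
  second-factor-remainder (inj₁ refl) = solve-∀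
  second-factor-remainder (inj₂ refl) = solve-∀

  value-gap : ∀ {e} → IsSign e → ∀ q x → x * (q + 1ℤ) ≡ e * (x * (q * x + e) - q * x * (x - e))
  value-gap (inj₁ refl) = solve-∀
  value-gap (inj₂ refl) = solve-∀

  black-count-identity : ∀ {e} → IsSign e → ∀ q x →
    e * (x * (q * x + e) * (x * x - 1ℤ) + x * (q * x + e) * (q * q - 1ℤ) * (x * x)
         - q * x * (q * q * x - e) * (x * x - 1ℤ) - (q + 1ℤ) * (q * q - 1ℤ) * (x * x))
      ≡ x * (q + 1ℤ) * ((q * x + e) * (x - e))
  black-count-identity (inj₁ refl) = solve-∀
  black-count-identity (inj₂ refl) = solve-∀

-- Used with x = q^(s-1) and e = (-1)^(s-1); β and ω are then the black and white values of (q + 1)·deg.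
module BlackPoints (q x e : ℤ) (sign : SignedIdentities.IsSign e) where
  open import Data.Integer using (ℤ; 0ℤ; 1ℤ; _+_; _-_; _*_; ≢-nonZero)
  open import Data.Integer.Properties
    using (i≡j⇒i-j≡0; i-j≡0⇒i≡j; i*j≡0⇒i≡0∨j≡0; *-zeroˡ; *-zeroʳ; +-identityʳ; *-cancelˡ-≡)
  open import Data.Integer.Divisibility.Signed using (_∣_; divides)
  open import Data.Integer.Tactic.RingSolver using (solve-∀)
  open import Data.Sum using (inj₁; inj₂)
  open import Data.Empty using (⊥-elim)
  open import Relation.Nullary using (¬_)
  open import Relation.Binary.PropositionalEquality
  open ≡-Reasoning
  open SignedIdentities

  c K β ω : ℤ
  c = q + 1ℤ
  K = q * q - 1ℤ
  β = q * x * (x - e)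
  ω = x * (q * x + e)

  U V : ℤ → ℤ
  U n = c * n - q * x * (q * q * x - e)
  V n = c * (x + e) * n - x * (q * q * x + e) * (q * x + e)

  -- ∑_P (c·deg P - β)(c·deg P - ω) written with n = |Ω| and t = |PG(s-2, q²)|: there are t + x² + q² x²
  -- points, a hyperplane has t + x² of them, ∑ deg = n (t + x²) and ∑ deg² = n (n t + x²).
  quadratic : ℤ → ℤ → ℤ
  quadratic n t = c * c * (n * (n * t + x * x)) + β * ω * (t + x * x + q * q * (x * x)) - c * (β + ω) * (n * (t + x * x))

  quadratic-factors : ∀ n t → K * t ≡ x * x - 1ℤ →
    c * c * (n * (n * t + x * x)) + β * ω * (t + x * x + q * q * (x * x)) ≡ c * (β + ω) * (n * (t + x * x)) →
    (x - e) * (U n * V n) ≡ 0ℤ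
  quadratic-factors n t θ-rel vanishing = begin
    (x - e) * (U n * V n)                                ≡⟨ +-identityʳ _ ⟨
    (x - e) * (U n * V n) + 0ℤ                           ≡⟨ cong ((x - e) * (U n * V n) +_) (*-zeroˡ W) ⟨
    (x - e) * (U n * V n) + 0ℤ * W                       ≡⟨ cong (λ d → (x - e) * (U n * V n) + d * W) (i≡j⇒i-j≡0 θ-rel) ⟨
    (x - e) * (U n * V n) + (K * t - (x * x - 1ℤ)) * W   ≡⟨ factorisation sign q x n t ⟨
    K * quadratic n t                                    ≡⟨ cong (K *_) (i≡j⇒i-j≡0 vanishing) ⟩
    K * 0ℤ                                               ≡⟨ *-zeroʳ K ⟩
    0ℤ                                                   ∎
    where
    W : ℤ
    W = (c * n - β) * (c * n - ω)

  second-factor-divides : ∀ n → V n ≡ 0ℤ → x + e ∣ K * (q - 1ℤ)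
  second-factor-divides n V≡0 = divides w (begin
    K * (q - 1ℤ)           ≡⟨ second-factor-remainder sign q x n ⟩
    w * (x + e) + e * V n  ≡⟨ cong (λ v → w * (x + e) + e * v) V≡0 ⟩
    w * (x + e) + e * 0ℤ   ≡⟨ cong (w * (x + e) +_) (*-zeroʳ e) ⟩
    w * (x + e) + 0ℤ       ≡⟨ +-identityʳ _ ⟩
    w * (x + e)            ∎)
    where
    w : ℤ
    w = e * (q * q * q * (x * x) + e * (q * q + q - q * q * q) * x + K * (q - 1ℤ) - c * n)

  hyperplane-count : ∀ n t → x - e ≢ 0ℤ → ¬ (x + e ∣ K * (q - 1ℤ)) →
    K * t ≡ x * x - 1ℤ →
    c * c * (n * (n * t + x * x)) + β * ω * (t + x * x + q * q * (x * x)) ≡ c * (β + ω) * (n * (t + x * x)) →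
    c * n ≡ q * x * (q * q * x - e)
  hyperplane-count n t x-e≢0 ∤ θ-rel vanishing with i*j≡0⇒i≡0∨j≡0 (x - e) (quadratic-factors n t θ-rel vanishing)
  ... | inj₁ x-e≡0 = ⊥-elim (x-e≢0 x-e≡0)
  ... | inj₂ UV≡0 with i*j≡0⇒i≡0∨j≡0 (U n) UV≡0
  ...   | inj₁ U≡0 = i-j≡0⇒i≡j _ _ U≡0
  ...   | inj₂ V≡0 = ⊥-elim (∤ (second-factor-divides n V≡0))

  black-count : ∀ n t b w → x * c ≢ 0ℤ →
    c * n ≡ q * x * (q * q * x - e) → K * t ≡ x * x - 1ℤ →
    b + w ≡ t + x * x → β * b + ω * w ≡ c * (n * t + x * x) →
    K * b ≡ (q * x + e) * (x - e)
  black-count n t b w xc≢0 n-rel θ-rel total weighted = *-cancelˡ-≡ (x * c) _ _ {{≢-nonZero xc≢0}} (begin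
    x * c * (K * b)
      ≡⟨ cong (_* (K * b)) (value-gap sign q x) ⟩
    e * (ω - β) * (K * b)
      ≡⟨ regroup₁ e ω β K b w ⟩
    e * K * (ω * (b + w) - (β * b + ω * w))
      ≡⟨ cong₂ (λ u v → e * K * (ω * u - v)) total weighted ⟩
    e * K * (ω * (t + x * x) - c * (n * t + x * x))
      ≡⟨ regroup₂ e K ω c n t (x * x) ⟩
    e * (ω * (K * t) + ω * K * (x * x) - c * n * (K * t) - c * K * (x * x))
      ≡⟨ cong₂ (λ u v → e * (ω * u + ω * K * (x * x) - v * u - c * K * (x * x))) θ-rel n-rel ⟩
    e * (ω * (x * x - 1ℤ) + ω * K * (x * x) - q * x * (q * q * x - e) * (x * x - 1ℤ) - c * K * (x * x))
      ≡⟨ black-count-identity sign q x ⟩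
    x * c * ((q * x + e) * (x - e)) ∎)
    where
    regroup₁ : ∀ e ω β K b w → e * (ω - β) * (K * b) ≡ e * K * (ω * (b + w) - (β * b + ω * w))
    regroup₁ = solve-∀
    regroup₂ : ∀ e K ω c n t y →
      e * K * (ω * (t + y) - c * (n * t + y)) ≡ e * (ω * (K * t) + ω * K * y - c * n * (K * t) - c * K * y)
    regroup₂ = solve-∀

module PowerArithmetic where
  open import Data.Nat as ℕ using (ℕ; zero; suc; _≤_; _<_; s≤s; z≤n)
  open import Data.Nat.Properties
    using (≤-refl; ≤-trans; ≤-reflexive; m≤m+n; n≤1+n; ≤-pred; ^-monoʳ-≤; *-identityʳ; module ≤-Reasoning)
  open import Data.Nat.Divisibility using (_∣_; divides; >⇒∤; ∣m+n∣m⇒∣n)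
  open import Data.Nat.Tactic.RingSolver using (solve-∀)
  open import Data.Integer using (ℤ; +_; 0ℤ; 1ℤ; -1ℤ; _+_; _-_; _*_; _^_; ∣_∣)
  open import Data.Integer.Properties using (pos-*; abs-*; i*j≡0⇒i≡0∨j≡0; i^n≡0⇒i≡0)
  import Data.Integer.Divisibility.Signed as Signed
  open import Data.Sum using (inj₁; inj₂)
  open import Relation.Nullary using (¬_)
  open import Function using (_∘_)
  open import Relation.Binary.PropositionalEquality
  open SignedIdentities using (IsSign)

  pos-^ : ∀ a k → + (a ℕ.^ k) ≡ (+ a) ^ k
  pos-^ a zero = refl
  pos-^ a (suc k) = trans (pos-* a (a ℕ.^ k)) (cong (+ a *_) (pos-^ a k))

  neg1^-sign : ∀ k → IsSign (neg1^ k)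
  neg1^-sign zero = inj₁ refl
  neg1^-sign (suc k) with neg1^-sign k
  ... | inj₁ e≡1 = inj₂ (cong (-1ℤ *_) e≡1)
  ... | inj₂ e≡-1 = inj₁ (cong (-1ℤ *_) e≡-1)

  ≤-suc-∣+e∣ : ∀ a {e} → IsSign e → a ≤ suc ∣ + a + e ∣
  ≤-suc-∣+e∣ a (inj₁ refl) = ≤-trans (m≤m+n a 1) (n≤1+n _)
  ≤-suc-∣+e∣ zero (inj₂ refl) = z≤n
  ≤-suc-∣+e∣ (suc a) (inj₂ refl) = ≤-refl

  abs-[q²-1][q-1] : ∀ p → let q = + suc (suc p) in ∣ (q * q - 1ℤ) * (q - 1ℤ) ∣ ≡ suc p ℕ.* (3 ℕ.+ p) ℕ.* suc p
  abs-[q²-1][q-1] p = trans (abs-* (q * q - 1ℤ) (q - 1ℤ)) (expand p)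
    where
    q : ℤ
    q = + suc (suc p)
    expand : ∀ p → (suc p ℕ.+ suc p ℕ.* suc (suc p)) ℕ.* suc p ≡ suc p ℕ.* (3 ℕ.+ p) ℕ.* suc p
    expand = solve-∀

  q²+1∤[q²-1][q-1] : ∀ p → let q = suc (suc p) in ¬ (q ℕ.* (q ℕ.* 1) ℕ.+ 1 ∣ suc p ℕ.* (3 ℕ.+ p) ℕ.* suc p)
  q²+1∤[q²-1][q-1] p d∣ = >⇒∤ small (∣m+n∣m⇒∣n (divides (suc p) (expand p)) d∣)
    where
    expand : ∀ p →
      suc p ℕ.* (3 ℕ.+ p) ℕ.* suc p ℕ.+ 2 ℕ.* suc p ≡ suc p ℕ.* (suc (suc p) ℕ.* (suc (suc p) ℕ.* 1) ℕ.+ 1)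
    expand = solve-∀
    square : ∀ p → suc (2 ℕ.* suc p) ℕ.+ (p ℕ.* p ℕ.+ 2 ℕ.* p ℕ.+ 2) ≡ suc (suc p) ℕ.* (suc (suc p) ℕ.* 1) ℕ.+ 1
    square = solve-∀
    small : 2 ℕ.* suc p < suc (suc p) ℕ.* (suc (suc p) ℕ.* 1) ℕ.+ 1
    small = ≤-trans (m≤m+n _ _) (≤-reflexive (square p))

  power±1∤[q²-1][q-1] : ∀ q t → 2 ≤ q → 2 ≤ t →
    ¬ (Signed._∣_ ((+ q) ^ t + neg1^ t) ((+ q * + q - 1ℤ) * (+ q - 1ℤ)))
  power±1∤[q²-1][q-1] 1 t (s≤s ())
  power±1∤[q²-1][q-1] (suc (suc p)) t _ 2≤t x+e∣ =
    ∤ t 2≤t (subst (∣ (+ q) ^ t + neg1^ t ∣ ∣_) (abs-[q²-1][q-1] p) (Signed.∣⇒∣ᵤ x+e∣))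
    where
    q N : ℕ
    q = suc (suc p)
    N = suc p ℕ.* (3 ℕ.+ p) ℕ.* suc p
    cube : ∀ p → 2 ℕ.+ suc p ℕ.* (3 ℕ.+ p) ℕ.* suc p ℕ.+ (p ℕ.* p ℕ.+ 5 ℕ.* p ℕ.+ 3)
                   ≡ suc (suc p) ℕ.* (suc (suc p) ℕ.* (suc (suc p) ℕ.* 1))
    cube = solve-∀
    ∤ : ∀ t → 2 ≤ t → ¬ (∣ (+ q) ^ t + neg1^ t ∣ ∣ N)
    ∤ 1 (s≤s ())
    ∤ 2 _ = q²+1∤[q²-1][q-1] p
    ∤ t@(suc (suc (suc _))) _ = >⇒∤ (≤-pred (begin
      2 ℕ.+ N                          ≤⟨ m≤m+n _ _ ⟩
      _                                ≡⟨ cube p ⟩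
      q ℕ.^ 3                          ≤⟨ ^-monoʳ-≤ q {3} {t} (s≤s (s≤s (s≤s z≤n))) ⟩
      q ℕ.^ t                          ≤⟨ ≤-suc-∣+e∣ (q ℕ.^ t) (neg1^-sign t) ⟩
      suc ∣ + (q ℕ.^ t) + neg1^ t ∣    ≡⟨ cong (λ x → suc ∣ x + neg1^ t ∣) (pos-^ q t) ⟩
      suc ∣ (+ q) ^ t + neg1^ t ∣      ∎))
      where open ≤-Reasoning

  2≤q^t : ∀ q t → 2 ≤ q → 1 ≤ t → 2 ≤ q ℕ.^ t
  2≤q^t 1 t (s≤s ()) _
  2≤q^t q@(suc (suc _)) t 2≤q 1≤t = ≤-trans 2≤q (≤-trans (≤-reflexive (sym (*-identityʳ q))) (^-monoʳ-≤ q 1≤t))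

  ±1-offset≢0 : ∀ a {e} → 2 ≤ a → IsSign e → + a - e ≢ 0ℤ
  ±1-offset≢0 1 (s≤s ()) _
  ±1-offset≢0 (suc (suc a)) _ (inj₁ refl) ()
  ±1-offset≢0 (suc (suc a)) _ (inj₂ refl) ()

  power-offset≢0 : ∀ q t {e} → 2 ≤ q → 1 ≤ t → IsSign e → (+ q) ^ t - e ≢ 0ℤ
  power-offset≢0 q t {e} 2≤q 1≤t sign =
    ±1-offset≢0 (q ℕ.^ t) (2≤q^t q t 2≤q 1≤t) sign ∘ subst (λ x → x - e ≡ 0ℤ) (sym (pos-^ q t))

  power*[q+1]≢0 : ∀ q t → 1 ≤ q → (+ q) ^ t * (+ q + 1ℤ) ≢ 0ℤ
  power*[q+1]≢0 q@(suc _) t _ x*c≡0 with i*j≡0⇒i≡0∨j≡0 ((+ q) ^ t) x*c≡0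
  ... | inj₂ ()
  ... | inj₁ x≡0 with i^n≡0⇒i≡0 (+ q) t x≡0
  ...   | ()

module Moments (q t : ℕ) (F : FieldOn (Fin (q Data.Nat.^ 2))) (Ω : Vec (Fin (q Data.Nat.^ 2)) (suc (suc t)) → Bool) where
  open import Data.Nat as ℕ using (ℕ; suc)
  import Data.Nat.Properties as ℕ
  open import Data.Integer using (ℤ; +_; 0ℤ; 1ℤ; -1ℤ; _+_; _-_; _*_; _^_; -_)
  open import Data.Integer.Properties using (pos-+; pos-*; ^-*-assoc; ^-distribˡ-+-*; +-inverseʳ; +-identityˡ; *-identityʳ)
  open import Data.Integer.Tactic.RingSolver using (solve-∀)
  open import Data.List.Membership.Propositional using (_∈_)
  open import Data.Bool using (true; false; T; not; _∧_; if_then_else_)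
  open import Data.Unit using (tt)
  open import Data.Sum using (_⊎_; inj₁; inj₂)
  open import Data.Empty using (⊥-elim)
  open import Function using (_∘_)
  open import Relation.Nullary.Decidable using (toWitness; toWitnessFalse)
  open import Relation.Binary.PropositionalEquality
  open ≡-Reasoning
  open Projective F using (points; hyperplanes; incident)
  open LinearAlgebra F using (V; normalized⇒nonzero)
  open Counting F using (θ; θ-suc; length-points; hyperplane-size)
  open DoubleCounting F t Ω using (n; deg; ∈-points⁻; ∑-degree; ∑-degree²; ∑-degree-on)
  open Sums
  open IntegerRelations
  open PowerArithmetic using (pos-^; neg1^-sign)
  open BlackPoints (+ q) ((+ q) ^ t) (neg1^ t) (neg1^-sign t) using (c; K; β; ω)

  private
    s m : ℕ
    s = suc t
    m = q ℕ.^ 2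

  Q X E N Θ : ℤ
  Q = + q
  X = (+ q) ^ t
  E = neg1^ t
  N = + n
  Θ = + θ t

  suc≡ : c ≡ + suc q
  suc≡ = trans (sym (pos-+ q 1)) (cong +_ (ℕ.+-comm q 1))

  black : V (suc s) → Bool
  black = isBlack F q s Ω

  Colouring : Set
  Colouring = ∀ P → P ∈ points s → c * + deg P ≡ (if black P then β else ω)

  colouring : (∀ P → P ∈ points s → (deg P ≐ blackNum q s ÷ (+ suc q)) ⊎ (deg P ≐ whiteNum q s ÷ (+ suc q))) →
    Colouring
  colouring two-degrees P P∈ with black P in is-black
  ... | true = trans (cong (_* + deg P) suc≡) (toWitness (subst T (sym is-black) tt))
  ... | false with two-degrees P P∈
  ...   | inj₁ blk = ⊥-elim (toWitnessFalse (subst (T ∘ not) (sym is-black) tt) blk)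
  ...   | inj₂ wht = trans (cong (_* + deg P) suc≡) (trans wht (cong (λ e → X * (Q * X + e)) (neg-neg E)))
    where
    neg-neg : ∀ e → - (-1ℤ * e) ≡ e
    neg-neg = solve-∀

  m≡ : + m ≡ Q * Q
  m≡ = trans (pos-^ q 2) (cong (Q *_) (*-identityʳ Q))

  m^t≡ : + (m ℕ.^ t) ≡ X * X
  m^t≡ = begin
    + (m ℕ.^ t)             ≡⟨ pos-^ m t ⟩
    (+ m) ^ t               ≡⟨ cong (_^ t) (pos-^ q 2) ⟩
    ((+ q) ^ 2) ^ t         ≡⟨ ^-*-assoc (+ q) 2 t ⟩
    (+ q) ^ (t ℕ.+ (t ℕ.+ 0)) ≡⟨ cong (λ k → (+ q) ^ (t ℕ.+ k)) (ℕ.+-identityʳ t) ⟩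
    (+ q) ^ (t ℕ.+ t)       ≡⟨ ^-distribˡ-+-* (+ q) t t ⟩
    X * X                   ∎

  θs≡ : + θ s ≡ Θ + X * X
  θs≡ = trans (pos-+ (θ t) (m ℕ.^ t)) (cong (λ u → Θ + u) m^t≡)

  θ-relation : K * Θ ≡ X * X - 1ℤ
  θ-relation = begin
    K * Θ                                              ≡⟨ rearrange Q Θ (X * X) ⟩
    (1ℤ + Q * Q * Θ) - (Θ + X * X) + (X * X - 1ℤ)     ≡⟨ cong (λ u → u - (Θ + X * X) + (X * X - 1ℤ)) θs≡′ ⟨
    (Θ + X * X) - (Θ + X * X) + (X * X - 1ℤ)          ≡⟨ cong (_+ (X * X - 1ℤ)) (+-inverseʳ (Θ + X * X)) ⟩
    0ℤ + (X * X - 1ℤ)                                 ≡⟨ +-identityˡ _ ⟩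
    X * X - 1ℤ                                        ∎
    where
    rearrange : ∀ q t y → (q * q - 1ℤ) * t ≡ (1ℤ + q * q * t) - (t + y) + (y - 1ℤ)
    rearrange = solve-∀
    θs≡′ : Θ + X * X ≡ 1ℤ + Q * Q * Θ
    θs≡′ = begin
      Θ + X * X           ≡⟨ θs≡ ⟨
      + θ s               ≡⟨ cong +_ (θ-suc t) ⟩
      + (1 ℕ.+ m ℕ.* θ t) ≡⟨ pos-+ 1 (m ℕ.* θ t) ⟩
      1ℤ + + (m ℕ.* θ t)  ≡⟨ cong (λ u → 1ℤ + u) (trans (pos-* m (θ t)) (cong (_* Θ) m≡)) ⟩
      1ℤ + Q * Q * Θ      ∎

  second-moment : Colouring →
    c * c * (N * (N * Θ + X * X)) + β * ω * (Θ + X * X + Q * Q * (X * X)) ≡ c * (β + ω) * (N * (Θ + X * X))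
  second-moment colours = begin
    c * c * (N * (N * Θ + X * X)) + β * ω * (Θ + X * X + Q * Q * (X * X))
      ≡⟨ cong₂ (λ u v → c * c * u + β * ω * v) ∑deg² ∑1 ⟨
    c * c * + ∑ (points s) (λ P → deg P ℕ.* deg P) + β * ω * + ∑ (points s) (λ _ → 1)
      ≡⟨ ∑-preserves-relation (c * c) (β * ω) (c * (β + ω)) _ _ deg (points s)
           (λ P P∈ → root-relation (black P) c β ω (deg P) (colours P P∈)) ⟩
    c * (β + ω) * + ∑ (points s) deg
      ≡⟨ cong (c * (β + ω) *_) ∑deg ⟩
    c * (β + ω) * (N * (Θ + X * X)) ∎
    where
    ∑deg : + ∑ (points s) deg ≡ N * (Θ + X * X)
    ∑deg = trans (cong +_ ∑-degree) (trans (pos-* n (θ s)) (cong (N *_) θs≡))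
    ∑deg² : + ∑ (points s) (λ P → deg P ℕ.* deg P) ≡ N * (N * Θ + X * X)
    ∑deg² = trans (cong +_ ∑-degree²)
                  (trans (pos-* n _) (cong (N *_) (trans (pos-+ (n ℕ.* θ t) _) (cong₂ _+_ (pos-* n (θ t)) m^t≡))))
    ∑1 : + ∑ (points s) (λ _ → 1) ≡ Θ + X * X + Q * Q * (X * X)
    ∑1 = begin
      + ∑ (points s) (λ _ → 1)  ≡⟨ cong +_ (trans (∑-const (points s) 1) (trans (ℕ.*-identityʳ _) (length-points s))) ⟩
      + θ (suc s)               ≡⟨ pos-+ (θ s) (m ℕ.* m ℕ.^ t) ⟩
      + θ s + + (m ℕ.* m ℕ.^ t) ≡⟨ cong₂ _+_ θs≡ (trans (pos-* m _) (cong₂ _*_ m≡ m^t≡)) ⟩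
      Θ + X * X + Q * Q * (X * X) ∎

  blacks whites : V (suc s) → ℕ
  blacks H = ∑ (points s) (λ P → ⟦ incident H P ∧ black P ⟧)
  whites H = ∑ (points s) (λ P → ⟦ incident H P ∧ not (black P) ⟧)

  blacks+whites : ∀ {H} → H ∈ hyperplanes s → + blacks H + + whites H ≡ Θ + X * X
  blacks+whites {H} H∈ = begin
    + blacks H + + whites H       ≡⟨ pos-+ (blacks H) (whites H) ⟨
    + (blacks H ℕ.+ whites H)     ≡⟨ cong +_ (∑-+ (points s) _ _) ⟨
    + ∑ (points s) (λ P → ⟦ incident H P ∧ black P ⟧ ℕ.+ ⟦ incident H P ∧ not (black P) ⟧)
                                  ≡⟨ cong +_ (∑-cong (points s) (λ P → ⟦∧⟧+⟦∧not⟧ (incident H P) (black P))) ⟩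
    + ∑ (points s) (λ P → ⟦ incident H P ⟧)
                                  ≡⟨ cong +_ (hyperplane-size s H (normalized⇒nonzero H (∈-points⁻ H∈))) ⟩
    + θ s                         ≡⟨ θs≡ ⟩
    Θ + X * X                     ∎

  first-moment-on : Colouring → ∀ {H} → H ∈ hyperplanes s → T (Ω H) →
    β * + blacks H + ω * + whites H ≡ c * (N * Θ + X * X)
  first-moment-on colours {H} H∈ ΩH = begin
    β * + blacks H + ω * + whites H
      ≡⟨ ∑-preserves-relation β ω c _ _ _ (points s)
           (λ P P∈ → split-relation (incident H P) (black P) c β ω (deg P) (colours P P∈)) ⟩
    c * + ∑ (points s) (λ P → ⟦ incident H P ⟧ ℕ.* deg P)
      ≡⟨ cong (λ u → c * + u) (∑-degree-on H∈ ΩH) ⟩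
    c * + (n ℕ.* θ t ℕ.+ m ℕ.^ t)
      ≡⟨ cong (c *_) (trans (pos-+ (n ℕ.* θ t) _) (cong₂ _+_ (pos-* n (θ t)) m^t≡)) ⟩
    c * (N * Θ + X * X) ∎

  K≡ : (+ q) ^ 2 - 1ℤ ≡ K
  K≡ = cong (λ u → Q * u - 1ℤ) (*-identityʳ Q)

open import Data.Nat using (ℕ; suc; _^_; _>_; _≥_; _≤_; s≤s; z≤n)
open import Data.Fin using (Fin)
open import Data.Vec using (Vec)
open import Data.Bool using (Bool; T; _∧_)
open import Data.List using (length; filterᵇ)
open import Data.List.Membership.Propositional using (_∈_)
open import Data.Integer using (+_; _-_; _*_; 0ℤ)
open import Data.Product using (∃; _×_)
open import Data.Sum using (_⊎_)
open import Data.Nat.Properties using (<⇒≤; ≤-trans)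
open import Relation.Binary.PropositionalEquality using (_≡_; _≢_; cong; cong₂; trans)

mainTheorem8 : (q s : ℕ) → IsPrimePower q → q > 2 → s ≥ 3
    → (F : FieldOn (Fin (q ^ 2)))
    → (Ω : Vec (Fin (q ^ 2)) (suc s) → Bool)
    → (∃ λ H → H ∈ Projective.hyperplanes F s × T (Ω H))
    → (∀ P → P ∈ Projective.points F s
         → (Projective.degree F s Ω P ≐ blackNum q s ÷ (+ (suc q)))
           ⊎ (Projective.degree F s Ω P ≐ whiteNum q s ÷ (+ (suc q))))
    → ∀ H → H ∈ Projective.hyperplanes F s → T (Ω H)
    → length (filterᵇ (λ P → Projective.incident F H P ∧ isBlack F q s Ω P) (Projective.points F s))
        ≐ hermNum q s ÷ (((+ q) Data.Integer.^ 2) - (+ 1))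
mainTheorem8 q (suc t) _ q>2 (s≤s 2≤t) F Ω _ two-degrees H H∈ ΩH =
  trans (cong₂ _*_ K≡ (cong +_ (Sums.length-filterᵇ _ (Projective.points F (suc t)))))
        (black-count N Θ (+ blacks H) (+ whites H) x*c≢0 |Ω| θ-relation (blacks+whites H∈) (first-moment-on colours H∈ ΩH))
  where
  open Moments q t F Ω
  open PowerArithmetic
  open BlackPoints Q X E (neg1^-sign t) using (c; hyperplane-count; black-count)
  2≤q : 2 ≤ q
  2≤q = <⇒≤ q>2
  colours : Colouring
  colours = colouring two-degrees
  x-e≢0 : X - E ≢ 0ℤ
  x-e≢0 = power-offset≢0 q t 2≤q (≤-trans (s≤s z≤n) 2≤t) (neg1^-sign t)
  x*c≢0 : X * c ≢ 0ℤ
  x*c≢0 = power*[q+1]≢0 q t (≤-trans (s≤s z≤n) 2≤q)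
  |Ω| : c * N ≡ Q * X * (Q * Q * X - E)
  |Ω| = hyperplane-count N Θ x-e≢0 (power±1∤[q²-1][q-1] q t 2≤q 2≤t) θ-relation (second-moment colours)
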